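{- Let $D=(F,R,>)$ be a decisive defeasible theory. Then for each literal $p$: (a) $D\vdash+\Delta p$ or $D\vdash-\Delta p$; and (b) $D\vdash+\partial p$ or $D\vdash-\partial p$.
   Context: Literals are atoms $p$ or negated atoms $\neg p$; for a literal $q$, $\sim q$ is its complement. A defeasible theory $D=(F,R,>)$ consists of a finite set $F$ of literals (facts), a finite set $R$ of propositional rules, and a binary relation $>$ on $R$ whose transitive closure is irreflexive. Each rule $r$ has a unique label, an antecedent $A(r)$ (finite set of literals), a head $C(r)$ (a literal) and a kind: strict ($\to$), defeasible ($\Rightarrow$) or defeater ($\leadsto$). $R_s$: strict rules; $R_{sd}$: strict or defeasible rules; $R[q]$, $R_s[q]$, $R_{sd}[q]$: those with head $q$. A derivation in $D$ is a finite sequence $P(1),\dots,P(n)$ of tagged literals $+\Delta q,-\Delta q,+\partial q,-\partial q$ such that for each $i$ (with $P(1..i)$ the initial segment of length $i$): ($+\Delta$) if $P(i+1)=+\Delta q$ then $q\in F$ or $\exists r\in R_s[q]\,\forall a\in A(r):+\Delta a\in P(1..i)$; ($-\Delta$) if $P(i+1)=-\Delta q$ then $q\notin F$ and $\forall r\in R_s[q]\,\exists a\in A(r): -\Delta a\in P(1..i)$; ($+\partial$) if $P(i+1)=+\partial q$ then either $+\Delta q\in P(1..i)$, or: $\exists r\in R_{sd}[q]\,\forall a\in A(r):+\partial a\in P(1..i)$, and $-\Delta\sim q\in P(1..i)$, and for every $s\in R[\sim q]$ either $\exists a\in A(s):-\partial a\in P(1..i)$ or $\exists t\in R_{sd}[q]$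 with $t>s$ and $\forall a\in A(t):+\partial a\in P(1..i)$; ($-\partial$) if $P(i+1)=-\partial q$ then $-\Delta q\in P(1..i)$ and either $\forall r\in R_{sd}[q]\,\exists a\in A(r):-\partial a\in P(1..i)$, or $+\Delta\sim q\in P(1..i)$, or $\exists s\in R[\sim q]$ with $\forall a\in A(s):+\partial a\in P(1..i)$ and for every $t\in R_{sd}[q]$ either $\exists a\in A(t):-\partial a\in P(1..i)$ or $t\not> s$. $D\vdash L$ means $L$ occurs in some derivation in $D$. The dependency graph $DG(D)$ is the directed graph whose points are the sets $\{q,\sim q\}$ for literals $q$ in $D$, with an arc from $\{b,\sim b\}$ to $\{a,\sim a\}$ whenever there is a rule $r\in R[b]$ with $a\in A(r)$. $D$ is decisive iff $DG(D)$ is acyclic. -}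

module Defs where

open import Data.Nat using (ℕ)
open import Data.List using (List; []; _∷_; _∷ʳ_; map)
open import Data.List.Membership.Propositional using (_∈_; _∉_)
open import Data.List.Relation.Unary.All using (All)
open import Data.List.Relation.Unary.Any using (Any)
open import Data.List.Relation.Unary.Unique.Propositional using (Unique)
open import Data.Product using (Σ; ∃; _×_; _,_)
open import Data.Sum using (_⊎_)
open import Relation.Nullary using (¬_)
open import Relation.Binary.PropositionalEquality using (_≡_)
open import Relation.Binary.Construct.Closure.Transitive using (TransClosure)

Atom : Set
Atom = ℕ

data Literal : Set where
  pos : Atom → Literal
  neg : Atom → Literal

∼_ : Literal → Literal
∼ pos p = neg p
∼ neg p = pos p

-- the point {q, ∼q} of the dependency graph, identified with the atom of q
atom : Literal → Atom
atom (pos p) = p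
atom (neg p) = p

data Kind : Set where
  strict defeasible defeater : Kind

record Rule : Set where
  constructor mkRule
  field
    label : ℕ
    ante  : List Literal
    head  : Literal
    kind  : Kind
open Rule public

IsStrict : Rule → Set
IsStrict r = kind r ≡ strict

IsSD : Rule → Set
IsSD r = kind r ≡ strict ⊎ kind r ≡ defeasible

-- D = (F, R, >) ; the superiority relation is a finite list of pairs (t , s) meaning t > s
record Theory : Set where
  constructor mkTheory
  field
    facts : List Literal
    rules : List Rule
    sup   : List (Rule × Rule)
open Theory public

_⊢_≻_ : Theory → Rule → Rule → Set
D ⊢ t ≻ s = (t , s) ∈ sup D

WellFormed : Theory → Set
WellFormed D =
  Unique (map label (rules D)) ×
  (∀ t s → D ⊢ t ≻ s → t ∈ rules D × s ∈ rules D) ×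
  (∀ r → ¬ TransClosure (D ⊢_≻_) r r)

data Tagged : Set where
  +Δ -Δ +∂ -∂ : Literal → Tagged

module _ (D : Theory) (P : List Tagged) where
  CondPlusΔ : Literal → Set
  CondPlusΔ q =
    q ∈ facts D ⊎
    (∃ λ r → r ∈ rules D × IsStrict r × head r ≡ q × All (λ a → +Δ a ∈ P) (ante r))

  CondMinusΔ : Literal → Set
  CondMinusΔ q =
    q ∉ facts D ×
    (∀ r → r ∈ rules D → IsStrict r → head r ≡ q → Any (λ a → -Δ a ∈ P) (ante r))

  CondPlus∂ : Literal → Set
  CondPlus∂ q =
    +Δ q ∈ P ⊎
    ((∃ λ r → r ∈ rules D × IsSD r × head r ≡ q × All (λ a → +∂ a ∈ P) (ante r)) ×
     -Δ (∼ q) ∈ P ×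
     (∀ s → s ∈ rules D → head s ≡ ∼ q →
        Any (λ a → -∂ a ∈ P) (ante s) ⊎
        (∃ λ t → t ∈ rules D × IsSD t × head t ≡ q × D ⊢ t ≻ s ×
                 All (λ a → +∂ a ∈ P) (ante t))))

  CondMinus∂ : Literal → Set
  CondMinus∂ q =
    -Δ q ∈ P ×
    ((∀ r → r ∈ rules D → IsSD r → head r ≡ q → Any (λ a → -∂ a ∈ P) (ante r)) ⊎
     +Δ (∼ q) ∈ P ⊎
     (∃ λ s → s ∈ rules D × head s ≡ ∼ q × All (λ a → +∂ a ∈ P) (ante s) ×
        (∀ t → t ∈ rules D → IsSD t → head t ≡ q →
           Any (λ a → -∂ a ∈ P) (ante t) ⊎ ¬ (D ⊢ t ≻ s))))

  Cond : Tagged → Set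
  Cond (+Δ q) = CondPlusΔ q
  Cond (-Δ q) = CondMinusΔ q
  Cond (+∂ q) = CondPlus∂ q
  Cond (-∂ q) = CondMinus∂ q

data Derivation (D : Theory) : List Tagged → Set where
  []   : Derivation D []
  step : ∀ {P t} → Derivation D P → Cond D P t → Derivation D (P ∷ʳ t)

_⊢_ : Theory → Tagged → Set
D ⊢ L = ∃ λ P → Derivation D P × L ∈ P

Arc : Theory → Atom → Atom → Set
Arc D x y = ∃ λ r → r ∈ rules D × atom (head r) ≡ x × Any (λ a → atom a ≡ y) (ante r)

Decisive : Theory → Set
Decisive D = ∀ x → ¬ TransClosure (Arc D) x x

{-# OPTIONS --safe #-}
-- Acyclicity of the finite dependency graph makes the converse of its arc relation well-founded;
-- induct along it. Derivations can be concatenated, since every inference condition is monotone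
-- in the preceding prefix, so one derivation settles the Δ- and ∂-status of all premises of all
-- rules for the point {p, ∼p}. Then each inference condition for p holds in its positive or its
-- negative form, rule by rule and premise by premise: this decides ±Δ p and ±Δ ∼p, and with
-- these in place ±∂ p.
module Submission where

open import Defs
open import Data.Empty using (⊥-elim)
open import Data.List using (List; []; _∷_; _∷ʳ_; _++_; [_]; map; filter; length)
open import Data.List.Properties using (++-assoc; ++-identityʳ; filter-notAll)
import Data.List.Properties as List
open import Data.List.Membership.Propositional using (_∈_; find)
import Data.List.Membership.DecPropositional
open import Data.List.Membership.Propositional.Properties using (∈-++⁺ˡ; ∈-++⁺ʳ; ∈-filter⁺; ∈-map⁺)
open import Data.List.Relation.Binary.Subset.Propositional using (_⊆_)
open import Data.List.Relation.Binary.Subset.Propositional.Properties using (⊆-trans)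
open import Data.List.Relation.Unary.All as All using (All; []; _∷_)
open import Data.List.Relation.Unary.Any as Any using (Any; here; there)
open import Data.Nat using (_<_)
import Data.Nat as ℕ
open import Data.Nat.Induction using (<-wellFounded)
open import Data.Product using (_×_; _,_; ∃; proj₁; proj₂)
import Data.Product.Properties as Product
open import Data.Sum using (_⊎_; inj₁; inj₂)
import Data.Sum as Sum
open import Function using (_∘_; flip)
open import Induction.WellFounded using (Acc; acc; WellFounded)
open import Relation.Binary using (DecidableEquality)
open import Relation.Binary.Construct.Closure.ReflexiveTransitive using (Star; ε; _◅_)
open import Relation.Binary.Construct.Closure.Transitive using (TransClosure; _∷_) renaming ([_] to [_]⁺)
open import Relation.Binary.PropositionalEquality using (_≡_; refl; sym; trans; cong; subst)
open import Relation.Nullary using (¬_; Dec; yes; no; ¬?)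
open import Relation.Nullary.Decidable using (map′; _×-dec_; _⊎-dec_)

infix 4 _≟ˡ_ _≟ᵏ_ _≟ʳ_

_≟ˡ_ : DecidableEquality Literal
pos p ≟ˡ pos q = map′ (cong pos) (λ { refl → refl }) (p ℕ.≟ q)
pos _ ≟ˡ neg _ = no λ ()
neg _ ≟ˡ pos _ = no λ ()
neg p ≟ˡ neg q = map′ (cong neg) (λ { refl → refl }) (p ℕ.≟ q)

_≟ᵏ_ : DecidableEquality Kind
strict     ≟ᵏ strict     = yes refl
strict     ≟ᵏ defeasible = no λ ()
strict     ≟ᵏ defeater   = no λ ()
defeasible ≟ᵏ strict     = no λ ()
defeasible ≟ᵏ defeasible = yes refl
defeasible ≟ᵏ defeater   = no λ ()
defeater   ≟ᵏ strict     = no λ ()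
defeater   ≟ᵏ defeasible = no λ ()
defeater   ≟ᵏ defeater   = yes refl

_≟ʳ_ : DecidableEquality Rule
mkRule l a h k ≟ʳ mkRule l′ a′ h′ k′ =
  map′ (λ { (refl , refl , refl , refl) → refl }) (λ { refl → refl , refl , refl , refl })
       (l ℕ.≟ l′ ×-dec List.≡-dec _≟ˡ_ a a′ ×-dec h ≟ˡ h′ ×-dec k ≟ᵏ k′)

module Literals  = Data.List.Membership.DecPropositional _≟ˡ_
module RulePairs = Data.List.Membership.DecPropositional (Product.≡-dec _≟ʳ_ _≟ʳ_)

isStrict? : (r : Rule) → Dec (IsStrict r)
isStrict? r = kind r ≟ᵏ strict

isSD? : (r : Rule) → Dec (IsSD r)
isSD? r = kind r ≟ᵏ strict ⊎-dec kind r ≟ᵏ defeasible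

atom-∼ : ∀ l → atom (∼ l) ≡ atom l
atom-∼ (pos p) = refl
atom-∼ (neg p) = refl

all⊎any : ∀ {A : Set} {P Q : A → Set} {xs} → All (λ x → P x ⊎ Q x) xs → All P xs ⊎ Any Q xs
all⊎any []             = inj₁ []
all⊎any (inj₂ q ∷ _)   = inj₂ (here q)
all⊎any (inj₁ p ∷ pqs) = Sum.map (p ∷_) there (all⊎any pqs)

dichotomy-under : ∀ {G H P Q : Set} → Dec G → Dec H → (G → H → P ⊎ Q) →
                  (G × H × P) ⊎ (G → H → Q)
dichotomy-under (no ¬g) _       _  = inj₂ λ g → ⊥-elim (¬g g)
dichotomy-under (yes g) (no ¬h) _  = inj₂ λ _ h → ⊥-elim (¬h h)
dichotomy-under (yes g) (yes h) pq = Sum.map (λ p → g , h , p) (λ q _ _ → q) (pq g h)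

∈-dichotomy : ∀ {A : Set} {P Q : A → Set} xs → (∀ x → x ∈ xs → P x ⊎ Q x) →
              (∃ λ x → x ∈ xs × P x) ⊎ (∀ x → x ∈ xs → Q x)
∈-dichotomy {P = P} {Q} xs pq with all⊎any {P = Q} {Q = P} (All.tabulate (Sum.swap ∘ pq _))
... | inj₁ qs = inj₂ λ x x∈xs → All.lookup qs x∈xs
... | inj₂ p  = inj₁ (find p)

module _ {A : Set} (_≟_ : DecidableEquality A) {R : A → A → Set}
         (sources : List A) (source∈ : ∀ {x y} → R x y → x ∈ sources)
         (acyclic : ∀ x → ¬ TransClosure R x x) where

  private
    ◅⁺ : ∀ {x y z} → R x y → Star R y z → TransClosure R x z
    ◅⁺ x→y ε            = [ x→y ]⁺
    ◅⁺ x→y (y→w ◅ w→*z) = x→y ∷ ◅⁺ y→w w→*z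

    CoversReachableSources : List A → A → Set
    CoversReachableSources K x = ∀ {v w} → Star R x v → R v w → v ∈ K

    -- After an arc x → y the source x is no longer reachable (acyclicity), so it can be
    -- dropped from K, and length K decreases.
    acc-by-sources : ∀ K → Acc _<_ (length K) → ∀ {x} → CoversReachableSources K x → Acc (flip R) x
    acc-by-sources K (acc rec) {x} K-covers = acc λ {y} x→y →
      acc-by-sources (filter ≢x? K)
        (rec (filter-notAll ≢x? K (Any.map (λ { refl x≢x → x≢x refl }) (K-covers ε x→y))))
        (λ y→*v v→w → ∈-filter⁺ ≢x? (K-covers (x→y ◅ y→*v) v→w)
                        λ { refl → acyclic x (◅⁺ x→y y→*v) })
      where
      ≢x? : ∀ v → Dec (¬ v ≡ x)
      ≢x? = ¬? ∘ (_≟ x)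

  finite-acyclic⇒wellFounded : WellFounded (flip R)
  finite-acyclic⇒wellFounded x = acc-by-sources sources (<-wellFounded _) (λ _ → source∈)

module Decision (D : Theory) where

  Cond-mono : ∀ {P Q} t → P ⊆ Q → Cond D P t → Cond D Q t
  Cond-mono (+Δ q) P⊆Q (inj₁ q∈F) = inj₁ q∈F
  Cond-mono (+Δ q) P⊆Q (inj₂ (r , r∈R , st , hr , app)) = inj₂ (r , r∈R , st , hr , All.map P⊆Q app)
  Cond-mono (-Δ q) P⊆Q (q∉F , disc) = q∉F , λ r r∈R st hr → Any.map P⊆Q (disc r r∈R st hr)
  Cond-mono (+∂ q) P⊆Q (inj₁ +Δq) = inj₁ (P⊆Q +Δq)
  Cond-mono (+∂ q) P⊆Q (inj₂ ((r , r∈R , sd , hr , app) , -Δ∼q , beaten)) =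
    inj₂ ((r , r∈R , sd , hr , All.map P⊆Q app) , P⊆Q -Δ∼q ,
          λ s s∈R hs → Sum.map (Any.map P⊆Q)
                               (λ (t , t∈R , sdt , ht , t≻s , appt) →
                                  t , t∈R , sdt , ht , t≻s , All.map P⊆Q appt)
                               (beaten s s∈R hs))
  Cond-mono (-∂ q) P⊆Q (-Δq , inj₁ disc) =
    P⊆Q -Δq , inj₁ λ r r∈R sd hr → Any.map P⊆Q (disc r r∈R sd hr)
  Cond-mono (-∂ q) P⊆Q (-Δq , inj₂ (inj₁ +Δ∼q)) = P⊆Q -Δq , inj₂ (inj₁ (P⊆Q +Δ∼q))
  Cond-mono (-∂ q) P⊆Q (-Δq , inj₂ (inj₂ (s , s∈R , hs , apps , unbeaten))) =
    P⊆Q -Δq , inj₂ (inj₂ (s , s∈R , hs , All.map P⊆Q apps ,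
                          λ t t∈R sdt ht → Sum.map₁ (Any.map P⊆Q) (unbeaten t t∈R sdt ht)))

  Derivation-++ : ∀ {P Q} → Derivation D P → Derivation D Q → Derivation D (P ++ Q)
  Derivation-++ {P} dP [] = subst (Derivation D) (sym (++-identityʳ P)) dP
  Derivation-++ {P} dP (step {Q} {t} dQ c) =
    subst (Derivation D) (++-assoc P Q [ t ]) (step (Derivation-++ dP dQ) (Cond-mono t (∈-++⁺ʳ P) c))

  Derivable : (List Tagged → Set) → Set
  Derivable Φ = ∃ λ P → Derivation D P × Φ P

  Monotone : ∀ {A : Set} → (List Tagged → A → Set) → Set
  Monotone Φ = ∀ {P Q} → P ⊆ Q → ∀ {x} → Φ P x → Φ Q x

  derivable-All : ∀ {A : Set} {Φ : List Tagged → A → Set} → Monotone Φ → ∀ xs →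
                  (∀ x → x ∈ xs → Derivable (λ P → Φ P x)) → Derivable (λ P → All (Φ P) xs)
  derivable-All mono []       _   = [] , [] , []
  derivable-All mono (x ∷ xs) der with der x (here refl) | derivable-All mono xs (λ y → der y ∘ there)
  ... | P , dP , φx | Q , dQ , φxs =
    P ++ Q , Derivation-++ dP dQ , mono ∈-++⁺ˡ φx ∷ All.map (mono (∈-++⁺ʳ P)) φxs

  extend : ∀ {P t t′} → Derivation D P → Cond D P t ⊎ Cond D P t′ →
           Derivable (λ P′ → P ⊆ P′ × (t ∈ P′ ⊎ t′ ∈ P′))
  extend {P} {t} dP (inj₁ c) = P ∷ʳ t , step dP c , ∈-++⁺ˡ , inj₁ (∈-++⁺ʳ P (here refl))
  extend {P} {t′ = t′} dP (inj₂ c) = P ∷ʳ t′ , step dP c , ∈-++⁺ˡ , inj₂ (∈-++⁺ʳ P (here refl))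

  DecidedΔ Decided∂ Decided : List Tagged → Literal → Set
  DecidedΔ P l = +Δ l ∈ P ⊎ -Δ l ∈ P
  Decided∂ P l = +∂ l ∈ P ⊎ -∂ l ∈ P
  Decided  P l = DecidedΔ P l × Decided∂ P l

  RulePremisesDecided : Atom → List Tagged → Rule → Set
  RulePremisesDecided x P r = atom (head r) ≡ x → All (Decided P) (ante r)

  PremisesDecided : List Tagged → Atom → Set
  PremisesDecided P x = All (RulePremisesDecided x P) (rules D)

  DecidedΔ-mono : Monotone DecidedΔ
  DecidedΔ-mono P⊆Q = Sum.map P⊆Q P⊆Q

  Decided-mono : Monotone Decided
  Decided-mono P⊆Q (Δ , ∂) = DecidedΔ-mono P⊆Q Δ , Sum.map P⊆Q P⊆Q ∂

  RulePremisesDecided-mono : ∀ x → Monotone (RulePremisesDecided x)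
  RulePremisesDecided-mono x P⊆Q premises hr = All.map (Decided-mono P⊆Q) (premises hr)

  PremisesDecided-mono : Monotone PremisesDecided
  PremisesDecided-mono P⊆Q {x} = All.map (λ {r} → RulePremisesDecided-mono x P⊆Q {r})

  PremisesDecided-∼ : ∀ {P} l → PremisesDecided P (atom l) → PremisesDecided P (atom (∼ l))
  PremisesDecided-∼ {P} l = subst (PremisesDecided P) (sym (atom-∼ l))

  module _ (P : List Tagged) where

    Applicable Discarded : (Literal → Tagged) → Rule → Set
    Applicable tag r = All (λ a → tag a ∈ P) (ante r)
    Discarded  tag r = Any (λ a → tag a ∈ P) (ante r)

    module _ {x} (premises : PremisesDecided P x) {r} (r∈R : r ∈ rules D) (hr : atom (head r) ≡ x) where

      Δ-applicable⊎discarded : Applicable +Δ r ⊎ Discarded -Δ r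
      Δ-applicable⊎discarded = all⊎any (All.map proj₁ (All.lookup premises r∈R hr))

      ∂-applicable⊎discarded : Applicable +∂ r ⊎ Discarded -∂ r
      ∂-applicable⊎discarded = all⊎any (All.map proj₂ (All.lookup premises r∈R hr))

    decideΔ : ∀ l → PremisesDecided P (atom l) → Cond D P (+Δ l) ⊎ Cond D P (-Δ l)
    decideΔ l premises with l Literals.∈? facts D
    ... | yes l∈F = inj₁ (inj₁ l∈F)
    ... | no  l∉F = Sum.map inj₂ (l∉F ,_) (∈-dichotomy (rules D) strict-rule-dichotomy)
      where
      strict-rule-dichotomy : ∀ r → r ∈ rules D →
        (IsStrict r × head r ≡ l × Applicable +Δ r) ⊎ (IsStrict r → head r ≡ l → Discarded -Δ r)
      strict-rule-dichotomy r r∈R = dichotomy-under (isStrict? r) (head r ≟ˡ l) λ _ hr →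
        Δ-applicable⊎discarded premises r∈R (cong atom hr)

    module _ l (premises : PremisesDecided P (atom l)) where

      support-dichotomy : ∀ r → r ∈ rules D →
        (IsSD r × head r ≡ l × Applicable +∂ r) ⊎ (IsSD r → head r ≡ l → Discarded -∂ r)
      support-dichotomy r r∈R = dichotomy-under (isSD? r) (head r ≟ˡ l) λ _ hr →
        ∂-applicable⊎discarded premises r∈R (cong atom hr)

      superiority-dichotomy : ∀ s t → t ∈ rules D →
        (IsSD t × head t ≡ l × D ⊢ t ≻ s × Applicable +∂ t) ⊎
        (IsSD t → head t ≡ l → Discarded -∂ t ⊎ ¬ D ⊢ t ≻ s)
      superiority-dichotomy s t t∈R = dichotomy-under (isSD? t) (head t ≟ˡ l) λ _ ht →
        by-superiority ((t , s) RulePairs.∈? sup D) (cong atom ht)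
        where
        by-superiority : Dec (D ⊢ t ≻ s) → atom (head t) ≡ atom l →
                         (D ⊢ t ≻ s × Applicable +∂ t) ⊎ (Discarded -∂ t ⊎ ¬ D ⊢ t ≻ s)
        by-superiority (yes t≻s) ht = Sum.map (t≻s ,_) inj₁ (∂-applicable⊎discarded premises t∈R ht)
        by-superiority (no  t⊁s) _  = inj₂ (inj₂ t⊁s)

      attack-dichotomy : ∀ s → s ∈ rules D →
        (head s ≡ ∼ l × Applicable +∂ s ×
          (∀ t → t ∈ rules D → IsSD t → head t ≡ l → Discarded -∂ t ⊎ ¬ D ⊢ t ≻ s)) ⊎
        (head s ≡ ∼ l → Discarded -∂ s ⊎
          (∃ λ t → t ∈ rules D × IsSD t × head t ≡ l × D ⊢ t ≻ s × Applicable +∂ t))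
      attack-dichotomy s s∈R with head s ≟ˡ ∼ l
      ... | no hs≢∼l = inj₂ (⊥-elim ∘ hs≢∼l)
      ... | yes hs with ∂-applicable⊎discarded premises s∈R (trans (cong atom hs) (atom-∼ l))
      ...   | inj₂ discarded  = inj₂ λ _ → inj₁ discarded
      ...   | inj₁ applicable with ∈-dichotomy (rules D) (superiority-dichotomy s)
      ...     | inj₁ beaten   = inj₂ λ _ → inj₂ beaten
      ...     | inj₂ unbeaten = inj₁ (hs , applicable , unbeaten)

      decide∂ : DecidedΔ P l → DecidedΔ P (∼ l) → Cond D P (+∂ l) ⊎ Cond D P (-∂ l)
      decide∂ (inj₁ +Δl) _           = inj₁ (inj₁ +Δl)
      decide∂ (inj₂ -Δl) (inj₁ +Δ∼l) = inj₂ (-Δl , inj₂ (inj₁ +Δ∼l))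
      decide∂ (inj₂ -Δl) (inj₂ -Δ∼l)
        with ∈-dichotomy (rules D) support-dichotomy | ∈-dichotomy (rules D) attack-dichotomy
      ... | inj₂ unsupported | _              = inj₂ (-Δl , inj₁ unsupported)
      ... | inj₁ _           | inj₁ undefeated = inj₂ (-Δl , inj₂ (inj₂ undefeated))
      ... | inj₁ supported   | inj₂ defeated   = inj₁ (inj₂ (supported , -Δ∼l , defeated))

  decide-literal : ∀ l → Derivable (λ P → PremisesDecided P (atom l)) → Derivable (λ P → Decided P l)
  decide-literal l (P , dP , premises) =
    let (P₁ , d₁ , P⊆P₁ , Δl)   = extend dP (decideΔ P l premises)
        (P₂ , d₂ , P₁⊆P₂ , Δ∼l) = extend d₁ (decideΔ P₁ (∼ l)
                                               (PremisesDecided-∼ l (PremisesDecided-mono P⊆P₁ premises)))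
        (P₃ , d₃ , P₂⊆P₃ , ∂l)  = extend d₂ (decide∂ P₂ l
                                               (PremisesDecided-mono (⊆-trans P⊆P₁ P₁⊆P₂) premises)
                                               (DecidedΔ-mono P₁⊆P₂ Δl) Δ∼l)
    in P₃ , d₃ , DecidedΔ-mono (⊆-trans P₁⊆P₂ P₂⊆P₃) Δl , ∂l

  premises-derivable : ∀ x →
    (∀ {r a} → r ∈ rules D → atom (head r) ≡ x → a ∈ ante r → Derivable (λ P → Decided P a)) →
    Derivable (λ P → PremisesDecided P x)
  premises-derivable x premise-derivable =
    derivable-All (RulePremisesDecided-mono x) (rules D) rule-premises
    where
    rule-premises : ∀ r → r ∈ rules D → Derivable (λ P → RulePremisesDecided x P r)
    rule-premises r r∈R with atom (head r) ℕ.≟ x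
    ... | no hr≢x = [] , [] , ⊥-elim ∘ hr≢x
    ... | yes hr =
      let (P , dP , decided) = derivable-All Decided-mono (ante r) (λ a → premise-derivable r∈R hr)
      in P , dP , λ _ → decided

  derivably-decided : ∀ l → Acc (flip (Arc D)) (atom l) → Derivable (λ P → Decided P l)
  derivably-decided l (acc rec) =
    decide-literal l (premises-derivable (atom l) λ {r} {a} r∈R hr a∈r →
      derivably-decided a (rec (r , r∈R , hr , Any.map (cong atom ∘ sym) a∈r)))

  decisive⇒wellFounded : Decisive D → WellFounded (flip (Arc D))
  decisive⇒wellFounded decisive =
    finite-acyclic⇒wellFounded ℕ._≟_ heads
      (λ (r , r∈R , hr , _) → subst (_∈ heads) hr (∈-map⁺ (atom ∘ head) r∈R)) decisive
    where
    heads : List Atom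
    heads = map (atom ∘ head) (rules D)

  derivable-either : ∀ {t t′} → Derivable (λ P → t ∈ P ⊎ t′ ∈ P) → (D ⊢ t) ⊎ (D ⊢ t′)
  derivable-either (P , dP , inj₁ t∈P)  = inj₁ (P , dP , t∈P)
  derivable-either (P , dP , inj₂ t′∈P) = inj₂ (P , dP , t′∈P)

  derivable-decided⇒⊢ : ∀ {l} → Derivable (λ P → Decided P l) →
                         ((D ⊢ +Δ l) ⊎ (D ⊢ -Δ l)) × ((D ⊢ +∂ l) ⊎ (D ⊢ -∂ l))
  derivable-decided⇒⊢ (P , dP , Δl , ∂l) =
    derivable-either (P , dP , Δl) , derivable-either (P , dP , ∂l)

theorem2p1 : (D : Theory) → WellFormed D → Decisive D → (p : Literal) →
    ((D ⊢ +Δ p) ⊎ (D ⊢ -Δ p)) × ((D ⊢ +∂ p) ⊎ (D ⊢ -∂ p))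
theorem2p1 D _ decisive p =
  derivable-decided⇒⊢ (derivably-decided p (decisive⇒wellFounded decisive (atom p)))
  where open Decision D
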